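{- Let $(G,k)$ be an instance of CTVD, let $S$ be a (clique, tree)-deletion set of $G$ with $|S| \le 4k$, let $V_1$ be the union of the vertex sets of the connected components of $G-S$ that are cliques with at least $3$ vertices, and $V_2 = V(G)\setminus(S\cup V_1)$. Let $v \in S$ be incident to at least $60(k+1)$ edges (counted with multiplicity) whose other endpoint lies in $V_2$. Let $H_v \subseteq V_2$ with $|H_v| \le 6k+4$ intersect every cycle, every paw and every diamond of $G[\{v\}\cup V_2]$ passing through $v$. Let $\mathcal{C}$ be the set of connected components of $G[V_2 \setminus H_v]$ that contain a neighbor of $v$, let $W = H_v \cup (S \setminus \{v\})$, and let $\mathcal{H}$ be the bipartite graph with parts $W$ and $\mathcal{C}$ where $h \in W$ is adjacent to $D \in \mathcal{C}$ iff $h$ has a neighbor in $D$ in $G$. Let $A \subseteq W$ and $\mathcal{B} \subseteq \mathcal{C}$ be such that there is a $4$-expansion $\widehat M$ of $A$ into $\mathcal{B}$ in $\mathcal{H}$, $N_{\mathcal{H}}(\mathcal{B}) \subseteq A$, and $|\mathcal{C} \setminus \mathcal{B}| \le 4|W \setminus A|$. Then for every minimum-size (clique, tree)-deletion set $X$ of $G$ with $|X| \le k$, we have $v \in X$ or $A \subseteq X$.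
   Context: CTVD: given a multigraph $G$ (loops and parallel edges allowed) and an integer $k$, decide whether there is $S\subseteq V(G)$ with $|S|\le k$ such that $G-S$ is simple and every connected component of $G-S$ is a clique or a tree. A (clique, tree)-deletion set of $G$ is any $X \subseteq V(G)$ such that $G - X$ is simple and each of its connected components is a clique or a tree. A paw is the graph on $u_1,u_2,u_3,u_4$ where $u_1,u_2,u_3$ form a triangle and $u_4$ is adjacent only to $u_1$; a diamond is the graph on $u_1,u_2,u_3,u_4$ where $u_1,u_2,u_3$ form a triangle and $u_4$ is adjacent exactly to $u_1,u_2$. For a bipartite graph with parts $P,Q$, $\hat P\subseteq P$, $\hat Q\subseteq Q$, a $4$-expansion of $\hat P$ into $\hat Q$ is a set $M$ of edges between $\hat P$ and $\hat Q$ such that every vertex of $\hat P$ is incident to exactly $4$ edges of $M$ and every vertex of $\hat Q$ is incident to at most one edge of $M$. -}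

module Defs where

open import Data.Nat using (ℕ; zero; suc; _+_; _*_; _≤_)
open import Data.Fin using (Fin)
open import Data.Fin.Subset public using (Subset; _∈_; _∉_; _⊆_; _∪_; _∩_; _─_; _-_; ∁; ⁅_⁆; ∣_∣)
open import Data.List using (List; []; _∷_; map; allFin; length)
open import Data.Nat.ListAction using (sum)
open import Data.List.Relation.Unary.All using (All)
open import Data.List.Relation.Unary.Any using (Any)
open import Data.List.Relation.Unary.Unique.Propositional using (Unique)
import Data.List.Membership.Propositional as LM
open import Data.Vec using (lookup)
open import Data.Bool using (if_then_else_)
open import Data.Product using (Σ; _×_; ∃)
open import Data.Sum using (_⊎_)
open import Data.Empty using (⊥)
open import Data.Unit using (⊤)
open import Relation.Binary.PropositionalEquality using (_≡_; _≢_)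
open import Relation.Nullary using (¬_)

-- A finite multigraph on vertex set Fin n: mult x y is the number of edges
-- between x and y (loops at x counted by mult x x).
record MultiGraph (n : ℕ) : Set where
  field
    mult : Fin n → Fin n → ℕ
    mult-sym : ∀ x y → mult x y ≡ mult y x
open MultiGraph public

module _ {n : ℕ} (G : MultiGraph n) where

  Adj : Fin n → Fin n → Set
  Adj x y = (x ≢ y) × (1 ≤ mult G x y)

  data Reach (U : Subset n) : Fin n → Fin n → Set where
    here : ∀ {x} → x ∈ U → Reach U x x
    step : ∀ {x y z} → x ∈ U → Adj x y → Reach U y z → Reach U x z

  Closes : Fin n → Fin n → List (Fin n) → Set
  Closes first cur [] = 1 ≤ mult G cur first
  Closes first cur (y ∷ ys) = (1 ≤ mult G cur y) × Closes first y ys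

  CycleEdges : List (Fin n) → Set
  CycleEdges [] = ⊥
  CycleEdges (a ∷ []) = 1 ≤ mult G a a
  CycleEdges (a ∷ b ∷ []) = 2 ≤ mult G a b
  CycleEdges (a ∷ b ∷ c ∷ rest) = Closes a a (b ∷ c ∷ rest)

  -- a cycle of the multigraph G, given by its (distinct) vertices in cyclic order
  IsCycle : List (Fin n) → Set
  IsCycle vs = Unique vs × CycleEdges vs

  SimpleOutside : Subset n → Set
  SimpleOutside X = (∀ x → x ∉ X → mult G x x ≡ 0)
                  × (∀ x y → x ∉ X → y ∉ X → mult G x y ≤ 1)

  Comp : Subset n → Fin n → Fin n → Set
  Comp U x y = Reach U x y

  CompIsClique : Subset n → Fin n → Set
  CompIsClique U x = ∀ y z → Comp U x y → Comp U x z → y ≢ z → Adj y z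

  -- connected (automatic for a component) and acyclic
  CompIsTree : Subset n → Fin n → Set
  CompIsTree U x = ∀ vs → IsCycle vs → All (Comp U x) vs → ⊥

  CTDeletionSet : Subset n → Set
  CTDeletionSet X = SimpleOutside X
                  × (∀ x → x ∉ X → CompIsClique (∁ X) x ⊎ CompIsTree (∁ X) x)

  CompIsBigClique : Subset n → Fin n → Set
  CompIsBigClique U x = CompIsClique U x
    × Σ (Fin n) λ a → Σ (Fin n) λ b → Σ (Fin n) λ c →
        Comp U x a × Comp U x b × Comp U x c × Unique (a ∷ b ∷ c ∷ [])

  edgesInto : Fin n → Subset n → ℕ
  edgesInto v T = sum (map (λ u → if lookup T u then mult G v u else 0) (allFin n))

  IsPawIn : Subset n → Fin n → Fin n → Fin n → Fin n → Set
  IsPawIn T u1 u2 u3 u4 = All (_∈ T) (u1 ∷ u2 ∷ u3 ∷ u4 ∷ [])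
    × Unique (u1 ∷ u2 ∷ u3 ∷ u4 ∷ [])
    × Adj u1 u2 × Adj u2 u3 × Adj u1 u3 × Adj u1 u4

  IsDiamondIn : Subset n → Fin n → Fin n → Fin n → Fin n → Set
  IsDiamondIn T u1 u2 u3 u4 = All (_∈ T) (u1 ∷ u2 ∷ u3 ∷ u4 ∷ [])
    × Unique (u1 ∷ u2 ∷ u3 ∷ u4 ∷ [])
    × Adj u1 u2 × Adj u2 u3 × Adj u1 u3 × Adj u1 u4 × Adj u2 u4

  HitsThrough : Fin n → Subset n → Subset n → Set
  HitsThrough v T H =
      (∀ vs → IsCycle vs → All (_∈ T) vs → v LM.∈ vs → Any (_∈ H) vs)
    × (∀ u1 u2 u3 u4 → IsPawIn T u1 u2 u3 u4 → v LM.∈ (u1 ∷ u2 ∷ u3 ∷ u4 ∷ [])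
         → Any (_∈ H) (u1 ∷ u2 ∷ u3 ∷ u4 ∷ []))
    × (∀ u1 u2 u3 u4 → IsDiamondIn T u1 u2 u3 u4 → v LM.∈ (u1 ∷ u2 ∷ u3 ∷ u4 ∷ [])
         → Any (_∈ H) (u1 ∷ u2 ∷ u3 ∷ u4 ∷ []))

  -- in the bipartite graph ℋ: h is adjacent to the component of x in G[U]
  -- iff h has a neighbour in that component
  TouchesComp : Subset n → Fin n → Fin n → Set
  TouchesComp U h x = Σ (Fin n) λ y → Comp U x y × Adj h y

-- Suppose v ∉ X and a ∈ A ∖ X. Each of the four components f a i of ℬ assigned to a is touched by
-- both v and a, so if two of them avoided X, v and a would lie on a cycle of G - X (or two neighbours
-- of v in different components would be adjacent, if the component of v in G - X is a clique). Hence X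
-- meets at least three of them, and as these components differ for different (a, i),
-- |X ∩ ⋃ℬ| ≥ 3 |A ∖ X|. On the other hand Y = (X ∖ ⋃ℬ) ∪ (A ∖ X) ∪ {v} is again a deletion set:
-- N(ℬ) ⊆ A ∪ {v} cuts ⋃ℬ off in G - Y, and ⋃ℬ ⊆ V₂ lies in components of G - S that are not big
-- cliques, hence trees. Minimality of X gives |X ∩ ⋃ℬ| ≤ |A ∖ X| + 1, so A ∖ X = ∅.

module Submission where

open import Defs
open import Data.Nat using (ℕ; zero; suc; _+_; _*_; _≤_; _≤?_; z≤n; s≤s; s≤s⁻¹)
open import Data.Nat.Properties
  using (≤-trans; ≤-reflexive; <⇒≤; ≰⇒>; <⇒≱; >⇒≢; n≮0; +-monoʳ-≤; *-monoʳ-≤; *-suc; +-suc; +-comm;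
         n≤1+n; +-cancelˡ-≤; n≤0⇒n≡0; m+1+n≢0; module ≤-Reasoning)
open import Data.Fin using (Fin; _≟_; #_)
open import Data.Fin.Subset using (_⊂_; inside; outside)
open import Data.Fin.Subset.Properties
  using (_∈?_; nonempty?; Empty-unique; ∣⊥∣≡0; ∣⁅x⁆∣≡1; ∣p∩q∣≤∣q∣; x∈⁅x⁆; p─q⊆p; x∈p∪q⁻; x∈p∪q⁺; x∈p∩q⁺;
         x∈p∧x∉q⇒x∈p─q; x∈p∧x≢y⇒x∈p-y; x∉p⇒x∈∁p; x∈∁p⇒x∉p; x∈p⇒p-x⊂p; x∈p⇒∣p-x∣<∣p∣)
open import Data.Fin.Subset.Induction using (Acc; acc; ⊂-wellFounded)
open import Data.Vec using ([]; _∷_; here; there)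
open import Data.List using (List; []; _∷_; _++_; length)
import Data.List.Membership.Propositional as List
import Data.List.Membership.DecPropositional as DecMembership
open import Data.List.Membership.Propositional.Properties using (∈-++⁻)
open import Data.List.Relation.Unary.All as All using (All; []; _∷_)
open import Data.List.Relation.Unary.All.Properties using (¬Any⇒All¬)
open import Data.List.Relation.Unary.Any using (Any; here; there)
open import Data.List.Relation.Unary.AllPairs using ([]; _∷_)
open import Data.List.Relation.Unary.Unique.Propositional using (Unique)
import Data.List.Relation.Unary.Unique.Propositional.Properties as Unique
open import Data.Product using (Σ; _×_; _,_; proj₁; proj₂)
open import Data.Sum using (_⊎_; inj₁; inj₂)
open import Data.Empty using (⊥; ⊥-elim)
open import Function using (_∘_)
open import Relation.Binary.PropositionalEquality using (_≡_; _≢_; refl; sym; trans; cong; subst)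
open import Relation.Nullary using (¬_; Dec; yes; no; contradiction)
open import Relation.Nullary.Decidable using (decidable-stable; ¬¬-excluded-middle)
open import Relation.Nullary.Negation using (¬¬-map)

3*m≤m+1⇒m≡0 : ∀ m → 3 * m ≤ m + 1 → m ≡ 0
3*m≤m+1⇒m≡0 zero    _  = refl
3*m≤m+1⇒m≡0 (suc m) le = contradiction (n≤0⇒n≡0 (s≤s⁻¹ (+-cancelˡ-≤ (suc m) _ _ le))) (m+1+n≢0 m)

∣p∪q∣≤∣p∣+∣q∣ : ∀ {n} (p q : Subset n) → ∣ p ∪ q ∣ ≤ ∣ p ∣ + ∣ q ∣
∣p∪q∣≤∣p∣+∣q∣ []            []            = z≤n
∣p∪q∣≤∣p∣+∣q∣ (inside ∷ p)  (inside ∷ q)  = s≤s (≤-trans (∣p∪q∣≤∣p∣+∣q∣ p q) (+-monoʳ-≤ ∣ p ∣ (n≤1+n ∣ q ∣)))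
∣p∪q∣≤∣p∣+∣q∣ (inside ∷ p)  (outside ∷ q) = s≤s (∣p∪q∣≤∣p∣+∣q∣ p q)
∣p∪q∣≤∣p∣+∣q∣ (outside ∷ p) (inside ∷ q)  = ≤-trans (s≤s (∣p∪q∣≤∣p∣+∣q∣ p q)) (≤-reflexive (sym (+-suc ∣ p ∣ ∣ q ∣)))
∣p∪q∣≤∣p∣+∣q∣ (outside ∷ p) (outside ∷ q) = ∣p∪q∣≤∣p∣+∣q∣ p q

∣p∣≡∣p─q∣+∣p∩q∣ : ∀ {n} (p q : Subset n) → ∣ p ∣ ≡ ∣ p ─ q ∣ + ∣ p ∩ q ∣
∣p∣≡∣p─q∣+∣p∩q∣ []            []            = refl
∣p∣≡∣p─q∣+∣p∩q∣ (inside ∷ p)  (inside ∷ q)  = trans (cong suc (∣p∣≡∣p─q∣+∣p∩q∣ p q)) (sym (+-suc _ _))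
∣p∣≡∣p─q∣+∣p∩q∣ (inside ∷ p)  (outside ∷ q) = cong suc (∣p∣≡∣p─q∣+∣p∩q∣ p q)
∣p∣≡∣p─q∣+∣p∩q∣ (outside ∷ p) (inside ∷ q)  = ∣p∣≡∣p─q∣+∣p∩q∣ p q
∣p∣≡∣p─q∣+∣p∩q∣ (outside ∷ p) (outside ∷ q) = ∣p∣≡∣p─q∣+∣p∩q∣ p q

∣p∣≤1+∣p-x∣ : ∀ {n} (p : Subset n) (x : Fin n) → ∣ p ∣ ≤ suc ∣ p - x ∣
∣p∣≤1+∣p-x∣ p x = begin
  ∣ p ∣                     ≡⟨ ∣p∣≡∣p─q∣+∣p∩q∣ p ⁅ x ⁆ ⟩
  ∣ p - x ∣ + ∣ p ∩ ⁅ x ⁆ ∣ ≤⟨ +-monoʳ-≤ ∣ p - x ∣ (≤-trans (∣p∩q∣≤∣q∣ p ⁅ x ⁆) (≤-reflexive (∣⁅x⁆∣≡1 x))) ⟩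
  ∣ p - x ∣ + 1             ≡⟨ +-comm ∣ p - x ∣ 1 ⟩
  suc ∣ p - x ∣             ∎
  where open ≤-Reasoning

x∈p─q⇒x∉q : ∀ {n} {x : Fin n} (p q : Subset n) → x ∈ p ─ q → x ∉ q
x∈p─q⇒x∉q (_ ∷ p) (outside ∷ q) (there x∈p─q) (there x∈q) = x∈p─q⇒x∉q p q x∈p─q x∈q
x∈p─q⇒x∉q (_ ∷ p) (inside ∷ q)  (there x∈p─q) (there x∈q) = x∈p─q⇒x∉q p q x∈p─q x∈q

ThreeDistinct : ∀ {A : Set} → (A → Set) → Set
ThreeDistinct {A} P = Σ A λ x → Σ A λ y → Σ A λ z →
  (x ≢ y × x ≢ z × y ≢ z) × (P x × P y × P z)

three-of-four : ∀ {Q : Fin 4 → Set} → (∀ {i j} → i ≢ j → ¬ Q i → ¬ Q j → ⊥) → ¬ ¬ ThreeDistinct Q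
three-of-four {Q} one-fails ¬three =
  ¬¬-excluded-middle λ Q₀? → ¬¬-excluded-middle λ Q₁? → cases Q₀? Q₁?
  where
  cases : Dec (Q (# 0)) → Dec (Q (# 1)) → ⊥
  cases (yes q₀) (yes q₁) = one-fails {# 2} {# 3} (λ ())
    (λ q₂ → ¬three (# 0 , # 1 , # 2 , ((λ ()) , (λ ()) , (λ ())) , q₀ , q₁ , q₂))
    (λ q₃ → ¬three (# 0 , # 1 , # 3 , ((λ ()) , (λ ()) , (λ ())) , q₀ , q₁ , q₃))
  cases (yes q₀) (no ¬q₁) = one-fails {# 1} {# 2} (λ ()) ¬q₁ λ q₂ → one-fails {# 1} {# 3} (λ ()) ¬q₁ λ q₃ →
    ¬three (# 0 , # 2 , # 3 , ((λ ()) , (λ ()) , (λ ())) , q₀ , q₂ , q₃)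
  cases (no ¬q₀) (yes q₁) = one-fails {# 0} {# 2} (λ ()) ¬q₀ λ q₂ → one-fails {# 0} {# 3} (λ ()) ¬q₀ λ q₃ →
    ¬three (# 1 , # 2 , # 3 , ((λ ()) , (λ ()) , (λ ())) , q₁ , q₂ , q₃)
  cases (no ¬q₀) (no ¬q₁) = one-fails {# 0} {# 1} (λ ()) ¬q₀ ¬q₁

module _ {n : ℕ} (R : Fin n → Fin n → Set) (R-injective : ∀ {a a′ w} → R a w → R a′ w → a ≡ a′) where

  3*∣p∣≤∣q∣ : (p q : Subset n) → (∀ {a w} → a ∈ p → R a w → w ∈ q)
            → (∀ {a} → a ∈ p → ¬ ¬ ThreeDistinct (R a)) → 3 * ∣ p ∣ ≤ ∣ q ∣
  3*∣p∣≤∣q∣ p q = go p q (⊂-wellFounded p)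
    where
    go : ∀ p q → Acc _⊂_ p → (∀ {a w} → a ∈ p → R a w → w ∈ q)
       → (∀ {a} → a ∈ p → ¬ ¬ ThreeDistinct (R a)) → 3 * ∣ p ∣ ≤ ∣ q ∣
    go p q (acc rec) R⊆q three with nonempty? p
    ... | no empty rewrite Empty-unique empty | ∣⊥∣≡0 n = z≤n
    ... | yes (a , a∈p) = decidable-stable (3 * ∣ p ∣ ≤? ∣ q ∣) (¬¬-map remove-a (three a∈p))
      where
      remove-a : ThreeDistinct (R a) → 3 * ∣ p ∣ ≤ ∣ q ∣
      remove-a (w₁ , w₂ , w₃ , (w₁≢w₂ , w₁≢w₃ , w₂≢w₃) , r₁ , r₂ , r₃) = begin
        3 * ∣ p ∣            ≤⟨ *-monoʳ-≤ 3 (∣p∣≤1+∣p-x∣ p a) ⟩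
        3 * suc ∣ p - a ∣    ≡⟨ *-suc 3 ∣ p - a ∣ ⟩
        3 + 3 * ∣ p - a ∣    ≤⟨ +-monoʳ-≤ 3 (go (p - a) q′ (rec (x∈p⇒p-x⊂p a∈p)) R⊆q′ (three ∘ p─q⊆p p _)) ⟩
        3 + ∣ q′ ∣           ≤⟨ s≤s (s≤s (x∈p⇒∣p-x∣<∣p∣ w₃∈q-w₁-w₂)) ⟩
        2 + ∣ q - w₁ - w₂ ∣  ≤⟨ s≤s (x∈p⇒∣p-x∣<∣p∣ w₂∈q-w₁) ⟩
        1 + ∣ q - w₁ ∣       ≤⟨ x∈p⇒∣p-x∣<∣p∣ (R⊆q a∈p r₁) ⟩
        ∣ q ∣                ∎
        where
        open ≤-Reasoning
        q′ = q - w₁ - w₂ - w₃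

        w₂∈q-w₁ : w₂ ∈ q - w₁
        w₂∈q-w₁ = x∈p∧x≢y⇒x∈p-y (R⊆q a∈p r₂) (w₁≢w₂ ∘ sym)

        w₃∈q-w₁-w₂ : w₃ ∈ q - w₁ - w₂
        w₃∈q-w₁-w₂ = x∈p∧x≢y⇒x∈p-y (x∈p∧x≢y⇒x∈p-y (R⊆q a∈p r₃) (w₁≢w₃ ∘ sym)) (w₂≢w₃ ∘ sym)

        R⊆q′ : ∀ {a′ w} → a′ ∈ p - a → R a′ w → w ∈ q′
        R⊆q′ {a′} {w} a′∈p-a r = avoid r₃ (avoid r₂ (avoid r₁ (R⊆q (p─q⊆p p _ a′∈p-a) r)))
          where
          avoid : ∀ {w′ q} → R a w′ → w ∈ q → w ∈ q - w′
          avoid r′ w∈q = x∈p∧x≢y⇒x∈p-y w∈q λ { refl →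
            x∈p─q⇒x∉q p _ a′∈p-a (subst (_∈ ⁅ a ⁆) (sym (R-injective r r′)) (x∈⁅x⁆ a)) }

module _ {n : ℕ} (G : MultiGraph n) where

  open DecMembership (_≟_ {n}) using () renaming (_∈?_ to _∈ₗ?_)

  Adj-sym : ∀ {x y} → Adj G x y → Adj G y x
  Adj-sym {x} {y} (x≢y , 1≤m) = x≢y ∘ sym , subst (1 ≤_) (mult-sym G x y) 1≤m

  reach-head : ∀ {U x y} → Reach G U x y → x ∈ U
  reach-head (here x∈U)     = x∈U
  reach-head (step x∈U _ _) = x∈U

  reach-last : ∀ {U x y} → Reach G U x y → y ∈ U
  reach-last (here y∈U)   = y∈U
  reach-last (step _ _ r) = reach-last r

  reach-trans : ∀ {U x y z} → Reach G U x y → Reach G U y z → Reach G U x z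
  reach-trans (here _)         r′ = r′
  reach-trans (step x∈U xy r) r′ = step x∈U xy (reach-trans r r′)

  reach-snoc : ∀ {U x y z} → Reach G U x y → Adj G y z → z ∈ U → Reach G U x z
  reach-snoc r yz z∈U = reach-trans r (step (reach-last r) yz (here z∈U))

  reach-sym : ∀ {U x y} → Reach G U x y → Reach G U y x
  reach-sym (here x∈U)       = here x∈U
  reach-sym (step x∈U xy r) = reach-snoc (reach-sym r) (Adj-sym xy) x∈U

  reach-mono : ∀ {U U′ x y} → (∀ {w} → Reach G U x w → w ∈ U′) → Reach G U x y → Reach G U′ x y
  reach-mono inU′ (here x∈U)      = here (inU′ (here x∈U))
  reach-mono inU′ (step x∈U xy r) = step (inU′ (here x∈U)) xy (reach-mono (inU′ ∘ step x∈U xy) r)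

  Walk : Fin n → List (Fin n) → Fin n → Set
  Walk x []       y = x ≡ y
  Walk x (z ∷ zs) y = Adj G x z × Walk z zs y

  SimpleWalk : Subset n → Fin n → Fin n → Set
  SimpleWalk U x y = Σ (List (Fin n)) λ zs →
    Walk x zs y × Unique (x ∷ zs) × All (Reach G U x) (x ∷ zs)

  private
    suffix-from : ∀ {P : Fin n → Set} {x y z} zs → x List.∈ y ∷ zs → Walk y zs z → Unique (y ∷ zs)
                → All P (y ∷ zs) → Σ (List (Fin n)) λ ws → Walk x ws z × Unique (x ∷ ws) × All P (x ∷ ws)
    suffix-from zs       (here refl) w u rs = zs , w , u , rs
    suffix-from (_ ∷ zs) (there x∈) (_ , w) (_ ∷ u) (_ ∷ rs) = suffix-from zs x∈ w u rs

  simple-walk : ∀ {U x y} → Reach G U x y → SimpleWalk U x y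
  simple-walk (here x∈U) = [] , refl , [] ∷ [] , here x∈U ∷ []
  simple-walk {x = x} (step {y = y} x∈U xy r) with simple-walk r
  ... | zs , w , u , rs with x ∈ₗ? y ∷ zs
  ...   | yes x∈ = suffix-from zs x∈ w u (All.map (step x∈U xy) rs)
  ...   | no x∉  = y ∷ zs , (xy , w) , ¬Any⇒All¬ _ x∉ ∷ u , here x∈U ∷ All.map (step x∈U xy) rs

  closes-++ : ∀ {f x zs y rest} → Walk x zs y → Closes G f y rest → Closes G f x (zs ++ rest)
  closes-++ {zs = []}     refl       cl = cl
  closes-++ {zs = _ ∷ _} (xz , walk) cl = proj₂ xz , closes-++ walk cl

  closes-walk : ∀ {f x zs y} → Walk x zs y → 1 ≤ mult G y f → Closes G f x zs
  closes-walk {zs = []}     refl       yf = yf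
  closes-walk {zs = _ ∷ _} (xz , walk) yf = proj₂ xz , closes-walk walk yf

  cycleEdges-closes : ∀ {f x} ys z zs → Closes G f f (x ∷ ys ++ z ∷ zs) → CycleEdges G (f ∷ x ∷ ys ++ z ∷ zs)
  cycleEdges-closes []      _ _ cl = cl
  cycleEdges-closes (_ ∷ _) _ _ cl = cl

  -- The cycle runs v, (through c₁), a, (through c₂), v along simple walks inside the components.
  cycle-through-two-components : ∀ {U v a c₁ c₂} → v ∉ U → a ∉ U → v ≢ a → ¬ Reach G U c₁ c₂
    → TouchesComp G U v c₁ → TouchesComp G U a c₁ → TouchesComp G U a c₂ → TouchesComp G U v c₂
    → Σ (List (Fin n)) λ ws → IsCycle G (v ∷ ws) × All (λ w → w ≡ a ⊎ Reach G U c₁ w ⊎ Reach G U c₂ w) ws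
  cycle-through-two-components {U} {v} {a} {c₁} {c₂} v∉U a∉U v≢a c₁≁c₂
    (y₁ , c₁y₁ , vy₁) (z₁ , c₁z₁ , az₁) (z₂ , c₂z₂ , az₂) (y₂ , c₂y₂ , vy₂)
    with simple-walk (reach-trans (reach-sym c₁y₁) c₁z₁) | simple-walk (reach-trans (reach-sym c₂z₂) c₂y₂)
  ... | ps , walk₁ , unique₁ , reach₁ | qs , walk₂ , unique₂ , reach₂ =
    ws , (All.tabulate (v≢ ∘ classify) ∷ unique-ws , edges) , All.tabulate classify
    where
    ws : List (Fin n)
    ws = (y₁ ∷ ps) ++ (a ∷ z₂ ∷ qs)

    in-c₁ : ∀ {w} → w List.∈ y₁ ∷ ps → Reach G U c₁ w
    in-c₁ w∈ = reach-trans c₁y₁ (All.lookup reach₁ w∈)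

    in-c₂ : ∀ {w} → w List.∈ z₂ ∷ qs → Reach G U c₂ w
    in-c₂ w∈ = reach-trans c₂z₂ (All.lookup reach₂ w∈)

    classify : ∀ {w} → w List.∈ ws → w ≡ a ⊎ Reach G U c₁ w ⊎ Reach G U c₂ w
    classify w∈ with ∈-++⁻ (y₁ ∷ ps) w∈
    ... | inj₁ w∈₁         = inj₂ (inj₁ (in-c₁ w∈₁))
    ... | inj₂ (here refl) = inj₁ refl
    ... | inj₂ (there w∈₂) = inj₂ (inj₂ (in-c₂ w∈₂))

    outside≢ : ∀ {x c w} → x ∉ U → Reach G U c w → x ≢ w
    outside≢ x∉U r refl = x∉U (reach-last r)

    v≢ : ∀ {w} → w ≡ a ⊎ Reach G U c₁ w ⊎ Reach G U c₂ w → v ≢ w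
    v≢ (inj₁ refl)      = v≢a
    v≢ (inj₂ (inj₁ r)) = outside≢ v∉U r
    v≢ (inj₂ (inj₂ r)) = outside≢ v∉U r

    unique-ws : Unique ws
    unique-ws = Unique.++⁺ unique₁ (All.tabulate (outside≢ a∉U ∘ in-c₂) ∷ unique₂) disjoint
      where
      disjoint : ∀ {w} → ¬ (w List.∈ y₁ ∷ ps × w List.∈ a ∷ z₂ ∷ qs)
      disjoint (w∈₁ , here refl)  = a∉U (reach-last (in-c₁ w∈₁))
      disjoint (w∈₁ , there w∈₂) = c₁≁c₂ (reach-trans (in-c₁ w∈₁) (reach-sym (in-c₂ w∈₂)))

    edges : CycleEdges G (v ∷ ws)
    edges = cycleEdges-closes ps a (z₂ ∷ qs)
      (proj₂ vy₁ , closes-++ walk₁ (proj₂ (Adj-sym az₁) , proj₂ az₂ , closes-walk walk₂ (proj₂ (Adj-sym vy₂))))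

  reach-into-X-free-component : ∀ {X U v c w} → v ∉ X → (∀ {w} → Reach G U c w → w ∉ X)
    → TouchesComp G U v c → Reach G U c w → Reach G (∁ X) v w
  reach-into-X-free-component v∉X free (y , cy , vy) cw = step (x∉p⇒x∈∁p v∉X) vy
    (reach-mono (λ yw → x∉p⇒x∈∁p (free (reach-trans cy yw))) (reach-trans (reach-sym cy) cw))

  X-free-components-with-two-common-neighbours-meet : ∀ {X U v a c₁ c₂}
    → CTDeletionSet G X → v ∉ X → a ∉ X → v ∉ U → a ∉ U → v ≢ a
    → (∀ {w} → Reach G U c₁ w → w ∉ X) → (∀ {w} → Reach G U c₂ w → w ∉ X)
    → TouchesComp G U v c₁ → TouchesComp G U a c₁ → TouchesComp G U a c₂ → TouchesComp G U v c₂
    → ¬ ¬ Reach G U c₁ c₂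
  X-free-components-with-two-common-neighbours-meet {X} {U} {v} {a} {c₁} {c₂}
    X-ct v∉X a∉X v∉U a∉U v≢a c₁-free c₂-free vc₁ ac₁ ac₂ vc₂ c₁≁c₂ with proj₂ X-ct v v∉X
  ... | inj₁ clique = c₁≁c₂ (joined vc₁ vc₂)
    where
    -- Two distinct neighbours of v in its clique component are adjacent, which merges the components.
    joined : TouchesComp G U v c₁ → TouchesComp G U v c₂ → Reach G U c₁ c₂
    joined (y₁ , c₁y₁ , vy₁) (y₂ , c₂y₂ , vy₂) with y₁ ≟ y₂
    ... | yes refl = reach-trans c₁y₁ (reach-sym c₂y₂)
    ... | no y₁≢y₂ = reach-trans c₁y₁ (step (reach-last c₁y₁) y₁y₂ (reach-sym c₂y₂))
      where
      y₁y₂ = clique y₁ y₂ (reach-into-X-free-component v∉X c₁-free (y₁ , c₁y₁ , vy₁) c₁y₁)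
                          (reach-into-X-free-component v∉X c₂-free (y₂ , c₂y₂ , vy₂) c₂y₂) y₁≢y₂
  ... | inj₂ tree with cycle-through-two-components v∉U a∉U v≢a c₁≁c₂ vc₁ ac₁ ac₂ vc₂
  ...   | ws , cycle , on-cycle = tree (v ∷ ws) cycle (here (x∉p⇒x∈∁p v∉X) ∷ All.map in-comp on-cycle)
    where
    in-comp : ∀ {w} → w ≡ a ⊎ Reach G U c₁ w ⊎ Reach G U c₂ w → Reach G (∁ X) v w
    in-comp (inj₁ refl) = reach-snoc (reach-into-X-free-component v∉X c₁-free vc₁ (proj₁ (proj₂ ac₁)))
                                     (Adj-sym (proj₂ (proj₂ ac₁))) (x∉p⇒x∈∁p a∉X)
    in-comp (inj₂ (inj₁ c₁w)) = reach-into-X-free-component v∉X c₁-free vc₁ c₁w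
    in-comp (inj₂ (inj₂ c₂w)) = reach-into-X-free-component v∉X c₂-free vc₂ c₂w

  bigClique-reach : ∀ {U x y} → Reach G U x y → CompIsBigClique G U y → CompIsBigClique G U x
  bigClique-reach xy (clique , a , b , c , ya , yb , yc , distinct) =
    (λ w z xw xz → clique w z (reach-trans (reach-sym xy) xw) (reach-trans (reach-sym xy) xz))
    , a , b , c , reach-trans xy ya , reach-trans xy yb , reach-trans xy yc , distinct

  -- In a simple graph a cycle has at least three vertices, so a clique component containing one is big.
  not-bigClique⇒tree : ∀ {Z x} → CTDeletionSet G Z → x ∉ Z → ¬ CompIsBigClique G (∁ Z) x → CompIsTree G (∁ Z) x
  not-bigClique⇒tree {Z} {x} ((loopless , simple) , shapes) x∉Z ¬big with shapes x x∉Z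
  ... | inj₂ tree   = tree
  ... | inj₁ clique = acyclic
    where
    acyclic : CompIsTree G (∁ Z) x
    acyclic (a ∷ []) (_ , loop) (xa ∷ _) =
      n≮0 (subst (1 ≤_) (loopless a (x∈∁p⇒x∉p (reach-last xa))) loop)
    acyclic (a ∷ b ∷ []) (_ , parallel) (xa ∷ xb ∷ _) =
      <⇒≱ parallel (simple a b (x∈∁p⇒x∉p (reach-last xa)) (x∈∁p⇒x∉p (reach-last xb)))
    acyclic (a ∷ b ∷ c ∷ _) (((a≢b ∷ a≢c ∷ _) ∷ (b≢c ∷ _) ∷ _) , _) (xa ∷ xb ∷ xc ∷ _) =
      ¬big (clique , a , b , c , xa , xb , xc , ((a≢b ∷ a≢c ∷ []) ∷ (b≢c ∷ []) ∷ [] ∷ []))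

  clique-or-tree-mono : ∀ {U U′ x} → (∀ {w} → Reach G U′ x w → Reach G U x w)
    → CompIsClique G U x ⊎ CompIsTree G U x → CompIsClique G U′ x ⊎ CompIsTree G U′ x
  clique-or-tree-mono reach (inj₁ clique) = inj₁ (λ y z xy xz → clique y z (reach xy) (reach xz))
  clique-or-tree-mono reach (inj₂ tree)   = inj₂ (λ vs cycle on → tree vs cycle (All.map reach on))

  -- Components of G - Y inside B lie in trees of G - Z; those outside B lie in components of G - X.
  glue-CTDeletionSets : ∀ {Z X Y B} → CTDeletionSet G Z → CTDeletionSet G X
    → (∀ {x} → x ∈ B → x ∉ Z × CompIsTree G (∁ Z) x)
    → (∀ {x} → x ∉ Y → x ∉ B → x ∉ X)
    → (∀ {x y} → x ∈ B → Adj G x y → y ∉ Y → y ∈ B)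
    → CTDeletionSet G Y
  glue-CTDeletionSets {Y = Y} {B} ((loopless-Z , simple-Z) , _) ((loopless-X , simple-X) , shapes-X)
    B-tree outside-B closed = (loopless , simple) , shapes
    where
    stays-in-B : ∀ {x w} → x ∈ B → Reach G (∁ Y) x w → w ∈ B
    stays-in-B x∈B (here _)          = x∈B
    stays-in-B x∈B (step _ xy yw) = stays-in-B (closed x∈B xy (x∈∁p⇒x∉p (reach-head yw))) yw

    stays-outside-B : ∀ {x w} → x ∉ B → Reach G (∁ Y) x w → w ∉ B
    stays-outside-B x∉B xw w∈B = x∉B (stays-in-B w∈B (reach-sym xw))

    simple-from-B : ∀ {x y} → x ∈ B → y ∉ Y → mult G x y ≤ 1
    simple-from-B {x} {y} x∈B y∉Y with x ≟ y | 1 ≤? mult G x y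
    ... | yes refl | _       = ≤-trans (≤-reflexive (loopless-Z x (proj₁ (B-tree x∈B)))) z≤n
    ... | no x≢y   | yes 1≤m = simple-Z x y (proj₁ (B-tree x∈B)) (proj₁ (B-tree (closed x∈B (x≢y , 1≤m) y∉Y)))
    ... | no _     | no 1≰m  = <⇒≤ (≰⇒> 1≰m)

    loopless : ∀ x → x ∉ Y → mult G x x ≡ 0
    loopless x x∉Y with x ∈? B
    ... | yes x∈B = loopless-Z x (proj₁ (B-tree x∈B))
    ... | no x∉B  = loopless-X x (outside-B x∉Y x∉B)

    simple : ∀ x y → x ∉ Y → y ∉ Y → mult G x y ≤ 1
    simple x y x∉Y y∉Y with x ∈? B | y ∈? B
    ... | yes x∈B | _       = simple-from-B x∈B y∉Y
    ... | no _    | yes y∈B = subst (_≤ 1) (mult-sym G y x) (simple-from-B y∈B x∉Y)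
    ... | no x∉B  | no y∉B  = simple-X x y (outside-B x∉Y x∉B) (outside-B y∉Y y∉B)

    shapes : ∀ x → x ∉ Y → CompIsClique G (∁ Y) x ⊎ CompIsTree G (∁ Y) x
    shapes x x∉Y with x ∈? B
    ... | yes x∈B = clique-or-tree-mono
          (reach-mono (λ xw → x∉p⇒x∈∁p (proj₁ (B-tree (stays-in-B x∈B xw))))) (inj₂ (proj₂ (B-tree x∈B)))
    ... | no x∉B  = clique-or-tree-mono
          (reach-mono (λ xw → x∉p⇒x∈∁p (outside-B (x∈∁p⇒x∉p (reach-last xw)) (stays-outside-B x∉B xw))))
          (shapes-X x (outside-B x∉Y x∉B))

module Exchange {n} (G : MultiGraph n)
  (S : Subset n) (S-ct : CTDeletionSet G S)
  (V₁ V₂ : Subset n)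
  (V₁⇒bigClique : ∀ x → x ∈ V₁ → x ∉ S × CompIsBigClique G (∁ S) x)
  (bigClique⇒V₁ : ∀ x → x ∉ S → CompIsBigClique G (∁ S) x → x ∈ V₁)
  (V₂⇒rest : ∀ x → x ∈ V₂ → x ∉ S × x ∉ V₁)
  (rest⇒V₂ : ∀ x → x ∉ S → x ∉ V₁ → x ∈ V₂)
  (v : Fin n) (v∈S : v ∈ S)
  (H : Subset n) (H⊆V₂ : H ⊆ V₂)
  (A B : Subset n)
  (A⊆W : A ⊆ (H ∪ (S - v)))
  (B⊆U : B ⊆ (V₂ ─ H))
  (B-closed : ∀ x y → x ∈ B → Reach G (V₂ ─ H) x y → y ∈ B)
  (B-touched : ∀ x → x ∈ B → TouchesComp G (V₂ ─ H) v x)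
  (f : Fin n → Fin 4 → Fin n)
  (f-into-B : ∀ a i → a ∈ A → f a i ∈ B × TouchesComp G (V₂ ─ H) a (f a i))
  (f-injective : ∀ a a′ i j → a ∈ A → a′ ∈ A → Reach G (V₂ ─ H) (f a i) (f a′ j) → (a ≡ a′) × (i ≡ j))
  (N[B]⊆A : ∀ h x → h ∈ (H ∪ (S - v)) → x ∈ B → TouchesComp G (V₂ ─ H) h x → h ∈ A)
  (X : Subset n) (X-ct : CTDeletionSet G X)
  (X-minimum : ∀ Y → CTDeletionSet G Y → ∣ X ∣ ≤ ∣ Y ∣)
  where

  U W : Subset n
  U = V₂ ─ H
  W = H ∪ (S - v)

  U⇒∉S : ∀ {x} → x ∈ U → x ∉ S
  U⇒∉S x∈U = proj₁ (V₂⇒rest _ (p─q⊆p V₂ H x∈U))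

  W⇒∉U : ∀ {x} → x ∈ W → x ∉ U
  W⇒∉U x∈W x∈U with x∈p∪q⁻ H (S - v) x∈W
  ... | inj₁ x∈H  = x∈p─q⇒x∉q V₂ H x∈U x∈H
  ... | inj₂ x∈S- = U⇒∉S x∈U (p─q⊆p S _ x∈S-)

  A⇒≢v : ∀ {x} → x ∈ A → x ≢ v
  A⇒≢v x∈A refl with x∈p∪q⁻ H (S - v) (A⊆W x∈A)
  ... | inj₁ v∈H  = proj₁ (V₂⇒rest v (H⊆V₂ v∈H)) v∈S
  ... | inj₂ v∈S- = x∈p─q⇒x∉q S _ v∈S- (x∈⁅x⁆ v)

  classify : ∀ {x} → x ≢ v → x ∈ W ⊎ x ∈ V₁ ⊎ x ∈ U
  classify {x} x≢v with x ∈? S | x ∈? V₁ | x ∈? H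
  ... | yes x∈S | _        | _       = inj₁ (x∈p∪q⁺ (inj₂ (x∈p∧x≢y⇒x∈p-y x∈S x≢v)))
  ... | no _    | yes x∈V₁ | _       = inj₂ (inj₁ x∈V₁)
  ... | no _    | no _     | yes x∈H = inj₁ (x∈p∪q⁺ (inj₁ x∈H))
  ... | no x∉S  | no x∉V₁  | no x∉H  = inj₂ (inj₂ (x∈p∧x∉q⇒x∈p─q (rest⇒V₂ x x∉S x∉V₁) x∉H))

  Y : Subset n
  Y = (X ─ B) ∪ ((A ─ X) ∪ ⁅ v ⁆)

  ∉Y⇒≢v : ∀ {x} → x ∉ Y → x ≢ v
  ∉Y⇒≢v x∉Y refl = x∉Y (x∈p∪q⁺ (inj₂ (x∈p∪q⁺ (inj₂ (x∈⁅x⁆ v)))))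

  ∉Y⇒∉B⇒∉X : ∀ {x} → x ∉ Y → x ∉ B → x ∉ X
  ∉Y⇒∉B⇒∉X x∉Y x∉B x∈X = x∉Y (x∈p∪q⁺ (inj₁ (x∈p∧x∉q⇒x∈p─q x∈X x∉B)))

  ∉Y⇒∉A : ∀ {x} → x ∉ Y → x ∉ A
  ∉Y⇒∉A {x} x∉Y x∈A with x ∈? X | x ∈? B
  ... | no x∉X  | _       = x∉Y (x∈p∪q⁺ (inj₂ (x∈p∪q⁺ (inj₁ (x∈p∧x∉q⇒x∈p─q x∈A x∉X)))))
  ... | yes _   | yes x∈B = W⇒∉U (A⊆W x∈A) (B⊆U x∈B)
  ... | yes x∈X | no x∉B  = ∉Y⇒∉B⇒∉X x∉Y x∉B x∈X

  B-closed-outside-Y : ∀ {x y} → x ∈ B → Adj G x y → y ∉ Y → y ∈ B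
  B-closed-outside-Y {x} {y} x∈B xy y∉Y with classify (∉Y⇒≢v y∉Y)
  ... | inj₁ y∈W =
    ⊥-elim (∉Y⇒∉A y∉Y (N[B]⊆A y x y∈W x∈B (x , here (B⊆U x∈B) , Adj-sym G xy)))
  ... | inj₂ (inj₁ y∈V₁) =
    ⊥-elim (proj₂ (V₂⇒rest x (p─q⊆p V₂ H (B⊆U x∈B)))
      (bigClique⇒V₁ x x∉S (bigClique-reach G (step (x∉p⇒x∈∁p x∉S) xy (here (x∉p⇒x∈∁p y∉S)))
                                               (proj₂ (V₁⇒bigClique y y∈V₁)))))
    where
    x∉S = U⇒∉S (B⊆U x∈B)
    y∉S = proj₁ (V₁⇒bigClique y y∈V₁)
  ... | inj₂ (inj₂ y∈U) = B-closed x y x∈B (step (B⊆U x∈B) xy (here y∈U))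

  B⇒tree : ∀ {x} → x ∈ B → x ∉ S × CompIsTree G (∁ S) x
  B⇒tree x∈B = x∉S , not-bigClique⇒tree G S-ct x∉S
    (proj₂ (V₂⇒rest _ (p─q⊆p V₂ H (B⊆U x∈B))) ∘ bigClique⇒V₁ _ x∉S)
    where x∉S = U⇒∉S (B⊆U x∈B)

  Y-ct : CTDeletionSet G Y
  Y-ct = glue-CTDeletionSets G S-ct X-ct B⇒tree ∉Y⇒∉B⇒∉X B-closed-outside-Y

  ∣X∩B∣≤∣A─X∣+1 : ∣ X ∩ B ∣ ≤ ∣ A ─ X ∣ + 1
  ∣X∩B∣≤∣A─X∣+1 = +-cancelˡ-≤ ∣ X ─ B ∣ _ _ (begin
    ∣ X ─ B ∣ + ∣ X ∩ B ∣                ≡⟨ sym (∣p∣≡∣p─q∣+∣p∩q∣ X B) ⟩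
    ∣ X ∣                                ≤⟨ X-minimum Y Y-ct ⟩
    ∣ Y ∣                                ≤⟨ ∣p∪q∣≤∣p∣+∣q∣ (X ─ B) _ ⟩
    ∣ X ─ B ∣ + ∣ (A ─ X) ∪ ⁅ v ⁆ ∣      ≤⟨ +-monoʳ-≤ ∣ X ─ B ∣ (∣p∪q∣≤∣p∣+∣q∣ (A ─ X) ⁅ v ⁆) ⟩
    ∣ X ─ B ∣ + (∣ A ─ X ∣ + ∣ ⁅ v ⁆ ∣)  ≡⟨ cong (λ k → ∣ X ─ B ∣ + (∣ A ─ X ∣ + k)) (∣⁅x⁆∣≡1 v) ⟩
    ∣ X ─ B ∣ + (∣ A ─ X ∣ + 1)          ∎)
    where open ≤-Reasoning

  Meets : Fin n → Fin 4 → Set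
  Meets a i = Σ (Fin n) λ w → w ∈ X × Reach G U (f a i) w

  same-component : ∀ {a a′ i j w} → a ∈ A → a′ ∈ A → Reach G U (f a i) w → Reach G U (f a′ j) w
                 → (a ≡ a′) × (i ≡ j)
  same-component a∈A a′∈A r r′ = f-injective _ _ _ _ a∈A a′∈A (reach-trans G r (reach-sym G r′))

  at-most-one-X-free : ∀ {a i j} → v ∉ X → a ∈ A → a ∉ X → i ≢ j → ¬ Meets a i → ¬ Meets a j → ⊥
  at-most-one-X-free {a} {i} {j} v∉X a∈A a∉X i≢j ¬i ¬j =
    X-free-components-with-two-common-neighbours-meet G X-ct v∉X a∉X
      (λ v∈U → U⇒∉S v∈U v∈S) (W⇒∉U (A⊆W a∈A)) (A⇒≢v a∈A ∘ sym) (free ¬i) (free ¬j)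
      (B-touched _ (proj₁ (f-into-B a i a∈A))) (proj₂ (f-into-B a i a∈A))
      (proj₂ (f-into-B a j a∈A)) (B-touched _ (proj₁ (f-into-B a j a∈A)))
      (i≢j ∘ proj₂ ∘ f-injective a a i j a∈A a∈A)
    where
    free : ∀ {k} → ¬ Meets a k → ∀ {w} → Reach G U (f a k) w → w ∉ X
    free ¬k r w∈X = ¬k (_ , w∈X , r)

  HitBy : Fin n → Fin n → Set
  HitBy a w = a ∈ A × w ∈ X × Σ (Fin 4) λ i → Reach G U (f a i) w

  three-hits : ∀ {a} → v ∉ X → a ∈ A ─ X → ¬ ¬ ThreeDistinct (HitBy a)
  three-hits {a} v∉X a∈A─X =
    ¬¬-map hits (three-of-four (at-most-one-X-free v∉X a∈A (x∈p─q⇒x∉q A X a∈A─X)))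
    where
    a∈A = p─q⊆p A X a∈A─X

    apart : ∀ {i j w w′} → i ≢ j → Reach G U (f a i) w → Reach G U (f a j) w′ → w ≢ w′
    apart i≢j r r′ refl = i≢j (proj₂ (same-component a∈A a∈A r r′))

    hits : ThreeDistinct (Meets a) → ThreeDistinct (HitBy a)
    hits (i , j , l , (i≢j , i≢l , j≢l) , (w₁ , w₁∈X , r₁) , (w₂ , w₂∈X , r₂) , (w₃ , w₃∈X , r₃)) =
      w₁ , w₂ , w₃ , (apart i≢j r₁ r₂ , apart i≢l r₁ r₃ , apart j≢l r₂ r₃)
      , (a∈A , w₁∈X , i , r₁) , (a∈A , w₂∈X , j , r₂) , (a∈A , w₃∈X , l , r₃)

  HitBy-injective : ∀ {a a′ w} → HitBy a w → HitBy a′ w → a ≡ a′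
  HitBy-injective (a∈A , _ , _ , r) (a′∈A , _ , _ , r′) = proj₁ (same-component a∈A a′∈A r r′)

  HitBy⇒∈X∩B : ∀ {a w} → HitBy a w → w ∈ X ∩ B
  HitBy⇒∈X∩B (a∈A , w∈X , i , r) = x∈p∩q⁺ (w∈X , B-closed _ _ (proj₁ (f-into-B _ i a∈A)) r)

  3*∣A─X∣≤∣X∩B∣ : v ∉ X → 3 * ∣ A ─ X ∣ ≤ ∣ X ∩ B ∣
  3*∣A─X∣≤∣X∩B∣ v∉X = 3*∣p∣≤∣q∣ HitBy HitBy-injective (A ─ X) (X ∩ B) (λ _ → HitBy⇒∈X∩B) (three-hits v∉X)

  v∉X⇒A⊆X : v ∉ X → A ⊆ X
  v∉X⇒A⊆X v∉X {a} a∈A with a ∈? X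
  ... | yes a∈X = a∈X
  ... | no a∉X  = ⊥-elim (>⇒≢ (≤-trans (s≤s z≤n) (x∈p⇒∣p-x∣<∣p∣ (x∈p∧x∉q⇒x∈p─q a∈A a∉X)))
                                ∣A─X∣≡0)
    where
    ∣A─X∣≡0 : ∣ A ─ X ∣ ≡ 0
    ∣A─X∣≡0 = 3*m≤m+1⇒m≡0 _ (≤-trans (3*∣A─X∣≤∣X∩B∣ v∉X) ∣X∩B∣≤∣A─X∣+1)

lemma32 : ∀ {n} (G : MultiGraph n) (k : ℕ)
    (S : Subset n) → CTDeletionSet G S → ∣ S ∣ ≤ 4 * k
    → (V₁ V₂ : Subset n)
    → (∀ x → x ∈ V₁ → x ∉ S × CompIsBigClique G (∁ S) x)
    → (∀ x → x ∉ S → CompIsBigClique G (∁ S) x → x ∈ V₁)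
    → (∀ x → x ∈ V₂ → x ∉ S × x ∉ V₁)
    → (∀ x → x ∉ S → x ∉ V₁ → x ∈ V₂)
    → (v : Fin n) → v ∈ S → 60 * (k + 1) ≤ edgesInto G v V₂
    → (H : Subset n) → H ⊆ V₂ → ∣ H ∣ ≤ 6 * k + 4
    → HitsThrough G v (⁅ v ⁆ ∪ V₂) H
    → (A B : Subset n)
    → A ⊆ (H ∪ (S - v))
    → B ⊆ (V₂ ─ H)
    → (∀ x y → x ∈ B → Reach G (V₂ ─ H) x y → y ∈ B)
    → (∀ x → x ∈ B → TouchesComp G (V₂ ─ H) v x)
    → Σ (Fin n → Fin 4 → Fin n) (λ f →
          (∀ a i → a ∈ A → f a i ∈ B × TouchesComp G (V₂ ─ H) a (f a i))
        × (∀ a a′ i j → a ∈ A → a′ ∈ A → Reach G (V₂ ─ H) (f a i) (f a′ j)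
             → (a ≡ a′) × (i ≡ j)))
    → (∀ h x → h ∈ (H ∪ (S - v)) → x ∈ B → TouchesComp G (V₂ ─ H) h x → h ∈ A)
    → Σ (List (Fin n)) (λ L → length L ≤ 4 * ∣ (H ∪ (S - v)) ─ A ∣
        × (∀ x → x ∈ (V₂ ─ H) → x ∉ B → TouchesComp G (V₂ ─ H) v x
             → Any (Reach G (V₂ ─ H) x) L))
    → ∀ (X : Subset n) → CTDeletionSet G X → ∣ X ∣ ≤ k
    → (∀ Y → CTDeletionSet G Y → ∣ X ∣ ≤ ∣ Y ∣)
    → v ∈ X ⊎ A ⊆ X
lemma32 G _ S S-ct _ V₁ V₂ V₁⇒bigClique bigClique⇒V₁ V₂⇒rest rest⇒V₂ v v∈S _ H H⊆V₂ _ _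
        A B A⊆W B⊆U B-closed B-touched (f , f-into-B , f-injective) N[B]⊆A _ X X-ct _ X-minimum
  with v ∈? X
... | yes v∈X = inj₁ v∈X
... | no v∉X  = inj₂ (Exchange.v∉X⇒A⊆X G S S-ct V₁ V₂ V₁⇒bigClique bigClique⇒V₁ V₂⇒rest rest⇒V₂ v v∈S
                        H H⊆V₂ A B A⊆W B⊆U B-closed B-touched f f-into-B f-injective N[B]⊆A X X-ct X-minimum v∉X)
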